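{- Let $\tau^{(1)},\tau^{(2)}$ be finitary permutations of the positive integers such that $i<j$ for all $i\in\mathrm{supp}(\tau^{(1)})$ and $j\in\mathrm{supp}(\tau^{(2)})$, and suppose their reduced cycle-types have sizes $r_1$ and $r_2$ respectively. Suppose $\sigma:=\tau^{(1)}\tau^{(2)}$ can be written as $\sigma=(s_1,t_1)\cdots(s_r,t_r)$ with $r=r_1+r_2$, $s_i<t_i$ for $1\le i\le r$, and $2\le t_1\le\dots\le t_r$. Then $$\tau^{(1)}=(s_1,t_1)\cdots(s_{r_1},t_{r_1}),\qquad \tau^{(2)}=(s_{r_1+1},t_{r_1+1})\cdots(s_r,t_r).$$
   Context: For a permutation $\sigma$ fixing all but finitely many positive integers, $\mathrm{supp}(\sigma)=\{i:\sigma(i)\ne i\}$. The reduced cycle-type of a permutation with cycle type $\nu$ (fixed points as parts $1$) is obtained by subtracting $1$ from each part of $\nu$; its size is the sum of its parts. Products of permutations are compositions (rightmost factor applied first). -}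

module Defs where

open import Data.Nat using (ℕ; zero; suc; _+_; _∸_; _≤_; _<_; _≡ᵇ_; _≤ᵇ_)
open import Data.Bool using (Bool; true; false; if_then_else_; _∧_)
open import Data.Product using (_×_; _,_; proj₁; proj₂; Σ)
open import Data.List using (List; []; _∷_; map)
open import Data.List.Relation.Unary.All using (All)
open import Data.List.Relation.Unary.Linked using (Linked)
open import Relation.Binary.PropositionalEquality using (_≡_; _≢_)
open import Function using (_∘_; id)

-- Permutations of the positive integers are represented as functions ℕ → ℕ
-- that fix 0 (0 plays no role; positive integers are 1,2,3,…).
record FinPerm : Set where
  field
    fun     : ℕ → ℕ
    inv     : ℕ → ℕ
    left    : ∀ i → inv (fun i) ≡ i
    right   : ∀ i → fun (inv i) ≡ i
    fix0    : fun 0 ≡ 0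
    bound   : ℕ
    fixHigh : ∀ i → bound ≤ i → fun i ≡ i
open FinPerm public

InSupp : FinPerm → ℕ → Set
InSupp σ i = fun σ i ≢ i

iter : (ℕ → ℕ) → ℕ → ℕ → ℕ
iter f zero    x = x
iter f (suc k) x = f (iter f k x)

-- length of the cycle of σ through i: least k ≥ 1 with σ^k(i) = i,
-- searched among 1..fuel (with fuel = bound σ + 1 this always succeeds).
cycLenAux : (ℕ → ℕ) → ℕ → ℕ → ℕ → ℕ
cycLenAux f i zero    k = k
cycLenAux f i (suc n) k = if iter f k i ≡ᵇ i then k else cycLenAux f i n (suc k)

cycLen : FinPerm → ℕ → ℕ
cycLen σ i = cycLenAux (fun σ) i (bound σ) 1

isCycMinAux : (ℕ → ℕ) → ℕ → ℕ → Bool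
isCycMinAux f i zero    = true
isCycMinAux f i (suc k) = (i ≤ᵇ iter f (suc k) i) ∧ isCycMinAux f i k

isCycMin : FinPerm → ℕ → Bool
isCycMin σ i = isCycMinAux (fun σ) i (cycLen σ i)

-- Size of the reduced cycle type: sum over cycles of (length − 1),
-- each cycle counted once via its least element.  All non-trivial cycles
-- lie in {1,…,bound−1}; fixed points contribute 1 − 1 = 0.
redSizeAux : FinPerm → ℕ → ℕ
redSizeAux σ zero    = 0
redSizeAux σ (suc n) =
  (if isCycMin σ (suc n) then cycLen σ (suc n) ∸ 1 else 0) + redSizeAux σ n

reducedSize : FinPerm → ℕ
reducedSize σ = redSizeAux σ (bound σ)

swap : ℕ → ℕ → ℕ → ℕ
swap s t x = if x ≡ᵇ s then t else (if x ≡ᵇ t then s else x)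

-- (s₁,t₁)(s₂,t₂)⋯(s_r,t_r), rightmost factor applied first
prodT : List (ℕ × ℕ) → ℕ → ℕ
prodT []            = id
prodT ((s , t) ∷ l) = swap s t ∘ prodT l

_≗ₚ_ : (ℕ → ℕ) → (ℕ → ℕ) → Set
f ≗ₚ g = ∀ i → f i ≡ g i

_·_ : FinPerm → FinPerm → ℕ → ℕ
τ · ρ = fun τ ∘ fun ρ

module Submission where

-- Measure a map f on [0,N) by sortCost f N, the number of
-- transpositions (f n, n) used by selection sort working down from N − 1.
--  (a) reducedSize τ ≤ sortCost τ: settling the top point cuts it out of its
--      cycle, lowering the reduced size by at most one.
--  (b) A transposition changes the sort cost by at most one, and by exactly
--      one if it crosses a threshold m whose upper block f respects.
--  (c) The sort cost is additive over factors with separated supports.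
-- Take a threshold m between the supports and cut the word as P S where the
-- t's reach m.  By (a) and (c) the word is no longer than the sort cost of
-- τ¹τ², so by (b) the suffix S is a minimal word and none of its letters can
-- cross m.  Then P S is a separated factorisation, hence P = τ¹, S = τ², and
-- counting with (a) gives |P| = r₁.

open import Defs
open import Data.Bool using (Bool; true; false; if_then_else_; _∧_; _∨_; T)
open import Data.Bool.Properties using (T-≡; ∧-conicalˡ; ∧-conicalʳ)
open import Data.Empty using (⊥-elim)
open import Data.Fin using (Fin; toℕ; fromℕ<)
open import Data.Fin.Properties using (pigeonhole; toℕ-fromℕ<; toℕ<n)
open import Data.List using (List; []; _∷_; length; map; take; drop)
open import Data.List.Properties using (length-++; take++drop≡id)
open import Data.List.Relation.Unary.All as All using (All; []; _∷_)
open import Data.List.Relation.Unary.All.Properties as All using (take⁺; drop⁺)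
open import Data.List.Relation.Unary.Linked as Linked using (Linked)
open import Data.List.Relation.Unary.Linked.Properties using (Linked⇒All)
open import Data.Nat using (ℕ; zero; suc; _+_; _∸_; _*_; _%_; _/_; _≤_; _<_; _≡ᵇ_; _≤ᵇ_; z≤n; s≤s; z<s; NonZero)
open import Data.Nat.DivMod using (m≡m%n+[m/n]*n; m%n<n)
open import Data.Nat.Properties
open import Algebra.Properties.CommutativeSemigroup +-commutativeSemigroup
  using () renaming (interchange to +-interchange)
open import Data.Product using (_×_; _,_; proj₁; proj₂; Σ)
open import Data.Sum using (_⊎_; inj₁; inj₂; [_,_]′)
open import Function using (_∘_; id)
open import Function.Bundles using (Equivalence)
open import Function.Definitions using (Injective)
open import Relation.Binary.PropositionalEquality
open import Relation.Nullary using (¬_; yes; no; Dec)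
open import Relation.Nullary.Decidable using (_×-dec_; ¬?; decidable-stable)

≡ᵇ-true : ∀ {x y} → x ≡ y → (x ≡ᵇ y) ≡ true
≡ᵇ-true {x} {y} p = Equivalence.to T-≡ (≡⇒≡ᵇ x y p)

≡ᵇ-false : ∀ {x y} → x ≢ y → (x ≡ᵇ y) ≡ false
≡ᵇ-false {x} {y} x≢y with x ≡ᵇ y in eq
... | true  = ⊥-elim (x≢y (≡ᵇ⇒≡ x y (Equivalence.from T-≡ eq)))
... | false = refl

≡ᵇ-sound : ∀ {x y} → (x ≡ᵇ y) ≡ true → x ≡ y
≡ᵇ-sound {x} {y} eq = ≡ᵇ⇒≡ x y (Equivalence.from T-≡ eq)

swap-s : ∀ s t → swap s t s ≡ t
swap-s s t rewrite ≡ᵇ-true {s} refl = refl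

swap-t : ∀ s t → swap s t t ≡ s
swap-t s t with t ≟ s
... | yes refl rewrite ≡ᵇ-true {t} refl = refl
... | no t≢s rewrite ≡ᵇ-false t≢s | ≡ᵇ-true {t} refl = refl

swap-other : ∀ {s t x} → x ≢ s → x ≢ t → swap s t x ≡ x
swap-other x≢s x≢t rewrite ≡ᵇ-false x≢s | ≡ᵇ-false x≢t = refl

swap-preserves : ∀ (P : ℕ → Set) s t x → P s → P t → P x → P (swap s t x)
swap-preserves P s t x ps pt px with x ≟ s
... | yes refl rewrite swap-s x t = pt
... | no x≢s with x ≟ t
... | yes refl rewrite swap-t s x = ps
... | no x≢t rewrite swap-other x≢s x≢t = px

swap-involutive : ∀ s t x → swap s t (swap s t x) ≡ x
swap-involutive s t x with x ≟ s
... | yes refl rewrite swap-s x t = swap-t x t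
... | no x≢s with x ≟ t
... | yes refl rewrite swap-t s x = swap-s s x
... | no x≢t rewrite swap-other x≢s x≢t = swap-other x≢s x≢t

swap-injective : ∀ s t → Injective _≡_ _≡_ (swap s t)
swap-injective s t {x} {y} e =
  trans (sym (swap-involutive s t x))
        (trans (cong (swap s t) e) (swap-involutive s t y))

swap-comm : ∀ s t x → swap s t x ≡ swap t s x
swap-comm s t x with x ≟ s | x ≟ t
... | yes refl | yes refl = refl
... | yes refl | no x≢t rewrite swap-s x t | swap-t t x = refl
... | no x≢s | yes refl rewrite swap-t s x | swap-s x s = refl
... | no x≢s | no x≢t rewrite swap-other {s} {t} x≢s x≢t | swap-other {t} {s} x≢t x≢s = refl

swap-conj : ∀ a b s t x →
  swap a b (swap s t x) ≡ swap (swap a b s) (swap a b t) (swap a b x)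
swap-conj a b s t x with x ≟ s
... | yes refl rewrite swap-s x t = sym (swap-s (swap a b x) (swap a b t))
... | no x≢s with x ≟ t
... | yes refl rewrite swap-t s x = sym (swap-t (swap a b s) (swap a b x))
... | no x≢t rewrite swap-other x≢s x≢t =
  sym (swap-other (x≢s ∘ swap-injective a b) (x≢t ∘ swap-injective a b))

FixesFrom : (ℕ → ℕ) → ℕ → Set
FixesFrom f m = ∀ x → m ≤ x → f x ≡ x

FixesBelow : (ℕ → ℕ) → ℕ → Set
FixesBelow f m = ∀ x → x < m → f x ≡ x

fun-injective : ∀ τ → Injective _≡_ _≡_ (fun τ)
fun-injective τ {x} {y} e = trans (sym (left τ x)) (trans (cong (inv τ) e) (left τ y))

injective-below : ∀ f m → Injective _≡_ _≡_ f → FixesFrom f m → ∀ x → x < m → f x < m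
injective-below f m f-inj f-fix x x<m with m ≤? f x
... | no m≰fx = ≰⇒> m≰fx
... | yes m≤fx = ⊥-elim (<⇒≱ x<m (subst (m ≤_) (f-inj (f-fix _ m≤fx)) m≤fx))

injective-above : ∀ f m → Injective _≡_ _≡_ f → FixesBelow f m → ∀ x → m ≤ x → m ≤ f x
injective-above f m f-inj f-fix x m≤x with m ≤? f x
... | yes m≤fx = m≤fx
... | no m≰fx = ⊥-elim (<⇒≱ (subst (_< m) (f-inj (f-fix _ (≰⇒> m≰fx))) (≰⇒> m≰fx)) m≤x)

-- Working down from position N-1 to 0, whenever
-- f n ≢ n we left-multiply by the transposition (f n, n), which makes n a
-- fixed point ("settles" n).  sortCost f N counts these transpositions; for a
-- permutation of [0,N) it is an upper bound for the reduced cycle-type size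
-- and it changes by at most one under multiplication by a transposition.

settle : (ℕ → ℕ) → ℕ → ℕ → ℕ
settle f n = swap (f n) n ∘ f

sortCost : (ℕ → ℕ) → ℕ → ℕ
sortCost f zero    = 0
sortCost f (suc n) = if f n ≡ᵇ n then sortCost f n else suc (sortCost (settle f n) n)

sortCost-fixed : ∀ f n → f n ≡ n → sortCost f (suc n) ≡ sortCost f n
sortCost-fixed f n p rewrite ≡ᵇ-true p = refl

sortCost-moved : ∀ f n → f n ≢ n → sortCost f (suc n) ≡ suc (sortCost (settle f n) n)
sortCost-moved f n p rewrite ≡ᵇ-false p = refl

sortCost-cong : ∀ N f g → (∀ x → f x ≡ g x) → sortCost f N ≡ sortCost g N
sortCost-cong zero    f g f≗g = refl
sortCost-cong (suc n) f g f≗g with f n ≟ n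
... | yes fn≡n = begin
  sortCost f (suc n) ≡⟨ sortCost-fixed f n fn≡n ⟩
  sortCost f n       ≡⟨ sortCost-cong n f g f≗g ⟩
  sortCost g n       ≡⟨ sortCost-fixed g n (trans (sym (f≗g n)) fn≡n) ⟨
  sortCost g (suc n) ∎
  where open ≡-Reasoning
... | no fn≢n = begin
  sortCost f (suc n)              ≡⟨ sortCost-moved f n fn≢n ⟩
  suc (sortCost (settle f n) n)   ≡⟨ cong suc (sortCost-cong n _ _ settle≗) ⟩
  suc (sortCost (settle g n) n)   ≡⟨ sortCost-moved g n (fn≢n ∘ trans (f≗g n)) ⟨
  sortCost g (suc n)              ∎
  where
  open ≡-Reasoning
  settle≗ : ∀ x → settle f n x ≡ settle g n x
  settle≗ x = cong₂ (λ a b → swap a n b) (f≗g n) (f≗g x)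

sortCost-id : ∀ N → sortCost id N ≡ 0
sortCost-id zero    = refl
sortCost-id (suc n) = trans (sortCost-fixed id n refl) (sortCost-id n)

sortCost-stable : ∀ f B N → B ≤ N → FixesFrom f B → sortCost f N ≡ sortCost f B
sortCost-stable f B N B≤N f-fix = trans (cong (sortCost f) (sym (m∸n+n≡m B≤N))) (extend (N ∸ B))
  where
  extend : ∀ k → sortCost f (k + B) ≡ sortCost f B
  extend zero    = refl
  extend (suc k) = trans (sortCost-fixed f (k + B) (f-fix _ (m≤n+m B k))) (extend k)

PermutesBelow : (ℕ → ℕ) → ℕ → Set
PermutesBelow f N = (∀ x → x < N → f x < N) × (∀ x y → x < N → y < N → f x ≡ f y → x ≡ y)

<-suc-≢ : ∀ {x n} → x < suc n → x ≢ n → x < n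
<-suc-≢ x<1+n x≢n = ≤∧≢⇒< (≤-pred x<1+n) x≢n

permutesBelow-id : ∀ N → PermutesBelow id N
permutesBelow-id N = (λ x x<N → x<N) , (λ x y _ _ e → e)

settle-permutes : ∀ f n → PermutesBelow f (suc n) → f n ≢ n → PermutesBelow (settle f n) n
settle-permutes f n (maps , inj) fn≢n .proj₁ x x<n with f x ≟ n
... | yes fx≡n rewrite fx≡n | swap-t (f n) n = <-suc-≢ (maps n ≤-refl) fn≢n
... | no fx≢n with f x ≟ f n
... | yes fx≡fn = ⊥-elim (<-irrefl (inj x n (m<n⇒m<1+n x<n) ≤-refl fx≡fn) x<n)
... | no fx≢fn rewrite swap-other fx≢fn fx≢n = <-suc-≢ (maps x (m<n⇒m<1+n x<n)) fx≢n
settle-permutes f n (maps , inj) fn≢n .proj₂ x y x<n y<n e =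
  inj x y (m<n⇒m<1+n x<n) (m<n⇒m<1+n y<n) (swap-injective (f n) n e)

permutesBelow-restrict : ∀ f n → PermutesBelow f (suc n) → f n ≡ n → PermutesBelow f n
permutesBelow-restrict f n (maps , inj) fn≡n = maps′ , λ x y x<n y<n → inj x y (m<n⇒m<1+n x<n) (m<n⇒m<1+n y<n)
  where
  maps′ : ∀ x → x < n → f x < n
  maps′ x x<n = <-suc-≢ (maps x (m<n⇒m<1+n x<n))
    (λ fx≡n → <-irrefl (inj x n (m<n⇒m<1+n x<n) ≤-refl (trans fx≡n (sym fn≡n))) x<n)

swap-permutes : ∀ f N s t → PermutesBelow f N → s < N → t < N → PermutesBelow (swap s t ∘ f) N
swap-permutes f N s t (maps , inj) s<N t<N =
  (λ x x<N → swap-preserves (_< N) s t (f x) s<N t<N (maps x x<N)) ,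
  (λ x y x<N y<N e → inj x y x<N y<N (swap-injective s t e))

settle-swap-away : ∀ f n s t → n ≢ s → n ≢ t → ∀ x → settle (swap s t ∘ f) n x ≡ swap s t (settle f n x)
settle-swap-away f n s t n≢s n≢t x with f n ≟ s
... | yes refl = trans (cong (λ z → swap (swap v t v) z (swap v t (f x))) (sym (swap-other n≢s n≢t)))
                       (sym (swap-conj v t v n (f x)))
  where v = f n
... | no fn≢s with f n ≟ t
... | yes refl = trans (cong (λ z → swap (swap s v v) z (swap s v (f x))) (sym (swap-other n≢s n≢t)))
                       (sym (swap-conj s v v n (f x)))
  where v = f n
... | no fn≢t rewrite swap-other fn≢s fn≢t =
  trans (swap-conj (f n) n s t (f x))
        (cong₂ (λ a b → swap a b (settle f n x)) (swap-other (fn≢s ∘ sym) (n≢s ∘ sym))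
                                                 (swap-other (fn≢t ∘ sym) (n≢t ∘ sym)))

settle-swap-top : ∀ f n s → f n ≢ s → f n ≢ n → s ≢ n →
  ∀ x → settle (swap s n ∘ f) n x ≡ swap s (f n) (settle f n x)
settle-swap-top f n s fn≢s fn≢n s≢n x =
  trans (cong (λ z → swap z n (swap s n (f x))) (swap-other fn≢s fn≢n))
        (trans (swap-conj (f n) n s n (f x))
               (cong₂ (λ a b → swap a b (settle f n x)) (swap-other (fn≢s ∘ sym) s≢n) (swap-t (f n) n)))

sortCost-swap-top-fixed : ∀ n f s → s < n → f n ≡ n →
  sortCost (swap s n ∘ f) (suc n) ≡ suc (sortCost f (suc n))
sortCost-swap-top-fixed n f s s<n fn≡n = begin
  sortCost (swap s n ∘ f) (suc n)                 ≡⟨ sortCost-moved (swap s n ∘ f) n (<⇒≢ s<n ∘ trans (sym σn≡s)) ⟩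
  suc (sortCost (settle (swap s n ∘ f) n) n)      ≡⟨ cong suc (sortCost-cong n _ _ undo) ⟩
  suc (sortCost f n)                              ≡⟨ cong suc (sortCost-fixed f n fn≡n) ⟨
  suc (sortCost f (suc n))                        ∎
  where
  open ≡-Reasoning
  σn≡s : swap s n (f n) ≡ s
  σn≡s = trans (cong (swap s n) fn≡n) (swap-t s n)
  undo : ∀ x → settle (swap s n ∘ f) n x ≡ f x
  undo x = trans (cong (λ z → swap z n (swap s n (f x))) σn≡s) (swap-involutive s n (f x))

sortCost-swap-top-moved : ∀ n f s → s < n → f n ≢ n → f n ≢ s →
  sortCost (swap s n ∘ f) (suc n) ≡ suc (sortCost (swap s (f n) ∘ settle f n) n)
sortCost-swap-top-moved n f s s<n fn≢n fn≢s =
  trans (sortCost-moved (swap s n ∘ f) n (fn≢n ∘ trans (sym (swap-other fn≢s fn≢n))))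
        (cong suc (sortCost-cong n _ _ (settle-swap-top f n s fn≢s fn≢n (<⇒≢ s<n))))

sortCost-swap-away-moved : ∀ n f s t → n ≢ s → n ≢ t → f n ≢ n →
  sortCost (swap s t ∘ f) (suc n) ≡ suc (sortCost (swap s t ∘ settle f n) n)
sortCost-swap-away-moved n f s t n≢s n≢t fn≢n =
  trans (sortCost-moved (swap s t ∘ f) n moved)
        (cong suc (sortCost-cong n _ _ (settle-swap-away f n s t n≢s n≢t)))
  where
  moved : swap s t (f n) ≢ n
  moved e = fn≢n (swap-injective s t (trans e (sym (swap-other n≢s n≢t))))

sortCost-swap-away-fixed : ∀ n f s t → n ≢ s → n ≢ t → f n ≡ n →
  sortCost (swap s t ∘ f) (suc n) ≡ sortCost (swap s t ∘ f) n
sortCost-swap-away-fixed n f s t n≢s n≢t fn≡n =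
  sortCost-fixed (swap s t ∘ f) n (trans (cong (swap s t) fn≡n) (swap-other n≢s n≢t))

SwapBound : ℕ → Set
SwapBound N = ∀ f s t → PermutesBelow f N → s < N → t < N → s ≢ t →
  sortCost (swap s t ∘ f) N ≤ suc (sortCost f N)

sortCost-swap-top≤ : ∀ n f s → PermutesBelow f (suc n) → s < n → SwapBound n →
  sortCost (swap s n ∘ f) (suc n) ≤ suc (sortCost f (suc n))
sortCost-swap-top≤ n f s f-perm s<n bound with f n ≟ n
... | yes fn≡n = ≤-reflexive (sortCost-swap-top-fixed n f s s<n fn≡n)
... | no fn≢n with f n ≟ s
... | yes refl = begin
  sortCost (swap (f n) n ∘ f) (suc n) ≡⟨ sortCost-fixed (swap (f n) n ∘ f) n (swap-s (f n) n) ⟩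
  sortCost (settle f n) n             ≤⟨ n≤1+n _ ⟩
  suc (sortCost (settle f n) n)       ≡⟨ sortCost-moved f n fn≢n ⟨
  sortCost f (suc n)                  ≤⟨ n≤1+n _ ⟩
  suc (sortCost f (suc n))            ∎
  where open ≤-Reasoning
... | no fn≢s = begin
  sortCost (swap s n ∘ f) (suc n)                   ≡⟨ sortCost-swap-top-moved n f s s<n fn≢n fn≢s ⟩
  suc (sortCost (swap s (f n) ∘ settle f n) n)      ≤⟨ s≤s (bound _ s (f n) (settle-permutes f n f-perm fn≢n) s<n
                                                         (<-suc-≢ (proj₁ f-perm n ≤-refl) fn≢n) (fn≢s ∘ sym)) ⟩
  suc (suc (sortCost (settle f n) n))               ≡⟨ cong suc (sortCost-moved f n fn≢n) ⟨
  suc (sortCost f (suc n))                          ∎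
  where open ≤-Reasoning

sortCost-swap≤ : ∀ N → SwapBound N
sortCost-swap≤ (suc n) f s t f-perm s<N t<N s≢t with s ≟ n | t ≟ n
... | yes refl | yes refl = ⊥-elim (s≢t refl)
... | yes refl | no t≢n = begin
  sortCost (swap s t ∘ f) (suc n) ≡⟨ sortCost-cong (suc n) _ _ (λ x → swap-comm s t (f x)) ⟩
  sortCost (swap t s ∘ f) (suc n) ≤⟨ sortCost-swap-top≤ n f t f-perm (<-suc-≢ t<N t≢n) (sortCost-swap≤ n) ⟩
  suc (sortCost f (suc n))        ∎
  where open ≤-Reasoning
... | no s≢n | yes refl = sortCost-swap-top≤ n f s f-perm (<-suc-≢ s<N s≢n) (sortCost-swap≤ n)
... | no s≢n | no t≢n with f n ≟ n
...   | yes fn≡n = begin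
  sortCost (swap s t ∘ f) (suc n) ≡⟨ sortCost-swap-away-fixed n f s t (s≢n ∘ sym) (t≢n ∘ sym) fn≡n ⟩
  sortCost (swap s t ∘ f) n       ≤⟨ sortCost-swap≤ n f s t (permutesBelow-restrict f n f-perm fn≡n)
                                       (<-suc-≢ s<N s≢n) (<-suc-≢ t<N t≢n) s≢t ⟩
  suc (sortCost f n)              ≡⟨ cong suc (sortCost-fixed f n fn≡n) ⟨
  suc (sortCost f (suc n))        ∎
  where open ≤-Reasoning
...   | no fn≢n = begin
  sortCost (swap s t ∘ f) (suc n)              ≡⟨ sortCost-swap-away-moved n f s t (s≢n ∘ sym) (t≢n ∘ sym) fn≢n ⟩
  suc (sortCost (swap s t ∘ settle f n) n)     ≤⟨ s≤s (sortCost-swap≤ n _ s t (settle-permutes f n f-perm fn≢n)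
                                                    (<-suc-≢ s<N s≢n) (<-suc-≢ t<N t≢n) s≢t) ⟩
  suc (suc (sortCost (settle f n) n))          ≡⟨ cong suc (sortCost-moved f n fn≢n) ⟨
  suc (sortCost f (suc n))                     ∎
  where open ≤-Reasoning

KeepsAbove : (ℕ → ℕ) → ℕ → ℕ → Set
KeepsAbove f m N = ∀ x → m ≤ x → x < N → m ≤ f x

keepsAbove-settle : ∀ f m n → KeepsAbove f m (suc n) → m ≤ n → KeepsAbove (settle f n) m n
keepsAbove-settle f m n keeps m≤n x m≤x x<n =
  swap-preserves (m ≤_) (f n) n (f x) (keeps n m≤n ≤-refl) m≤n (keeps x m≤x (m<n⇒m<1+n x<n))

sortCost-swap-cross : ∀ N f m s t → PermutesBelow f N → KeepsAbove f m N →
  s < m → m ≤ t → t < N → sortCost (swap s t ∘ f) N ≡ suc (sortCost f N)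
sortCost-swap-cross (suc n) f m s t f-perm keeps s<m m≤t t<N with t ≟ n
... | yes refl = top
  where
  open ≡-Reasoning
  top : sortCost (swap s t ∘ f) (suc t) ≡ suc (sortCost f (suc t))
  top with f t ≟ t
  ... | yes ft≡t = sortCost-swap-top-fixed t f s (<-≤-trans s<m m≤t) ft≡t
  ... | no ft≢t = begin
    sortCost (swap s t ∘ f) (suc t)                ≡⟨ sortCost-swap-top-moved t f s (<-≤-trans s<m m≤t) ft≢t ft≢s ⟩
    suc (sortCost (swap s (f t) ∘ settle f t) t)   ≡⟨ cong suc (sortCost-swap-cross t _ m s (f t)
                                                        (settle-permutes f t f-perm ft≢t) (keepsAbove-settle f m t keeps m≤t)
                                                        s<m m≤ft (<-suc-≢ (proj₁ f-perm t ≤-refl) ft≢t)) ⟩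
    suc (suc (sortCost (settle f t) t))            ≡⟨ cong suc (sortCost-moved f t ft≢t) ⟨
    suc (sortCost f (suc t))                       ∎
    where
    m≤ft : m ≤ f t
    m≤ft = keeps t m≤t ≤-refl
    ft≢s : f t ≢ s
    ft≢s e = <⇒≱ s<m (subst (m ≤_) e m≤ft)
... | no t≢n = below (t≢n ∘ sym) (λ n≡s → <⇒≱ (<-≤-trans s<m m≤t) (≤-trans (<⇒≤ t<n) (≤-reflexive n≡s)))
  where
  open ≡-Reasoning
  t<n : t < n
  t<n = <-suc-≢ t<N t≢n
  below : n ≢ t → n ≢ s → sortCost (swap s t ∘ f) (suc n) ≡ suc (sortCost f (suc n))
  below n≢t n≢s with f n ≟ n
  ... | yes fn≡n = begin
    sortCost (swap s t ∘ f) (suc n) ≡⟨ sortCost-swap-away-fixed n f s t n≢s n≢t fn≡n ⟩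
    sortCost (swap s t ∘ f) n       ≡⟨ sortCost-swap-cross n f m s t (permutesBelow-restrict f n f-perm fn≡n)
                                         (λ x m≤x x<n → keeps x m≤x (m<n⇒m<1+n x<n)) s<m m≤t t<n ⟩
    suc (sortCost f n)              ≡⟨ cong suc (sortCost-fixed f n fn≡n) ⟨
    suc (sortCost f (suc n))        ∎
  ... | no fn≢n = begin
    sortCost (swap s t ∘ f) (suc n)            ≡⟨ sortCost-swap-away-moved n f s t n≢s n≢t fn≢n ⟩
    suc (sortCost (swap s t ∘ settle f n) n)   ≡⟨ cong suc (sortCost-swap-cross n _ m s t (settle-permutes f n f-perm fn≢n)
                                                    (keepsAbove-settle f m n keeps (≤-trans m≤t (<⇒≤ t<n))) s<m m≤t t<n) ⟩
    suc (suc (sortCost (settle f n) n))        ≡⟨ cong suc (sortCost-moved f n fn≢n) ⟨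
    suc (sortCost f (suc n))                   ∎

swap-fixes-below : ∀ {m a b x} → m ≤ a → m ≤ b → x < m → swap a b x ≡ x
swap-fixes-below m≤a m≤b x<m =
  swap-other (λ x≡a → <⇒≱ x<m (subst (_ ≤_) (sym x≡a) m≤a)) (λ x≡b → <⇒≱ x<m (subst (_ ≤_) (sym x≡b) m≤b))

swap-fixes-above : ∀ {m a b x} → a < m → b < m → m ≤ x → swap a b x ≡ x
swap-fixes-above a<m b<m m≤x =
  swap-other (λ x≡a → <⇒≱ a<m (subst (_ ≤_) x≡a m≤x)) (λ x≡b → <⇒≱ b<m (subst (_ ≤_) x≡b m≤x))

swap-commutes-above : ∀ h m a b → Injective _≡_ _≡_ h → FixesFrom h m → m ≤ a → m ≤ b →
  ∀ y → swap a b (h y) ≡ h (swap a b y)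
swap-commutes-above h m a b h-inj h-fix m≤a m≤b y with m ≤? y
... | yes m≤y = trans (cong (swap a b) (h-fix y m≤y))
                      (sym (h-fix _ (swap-preserves (m ≤_) a b y m≤a m≤b m≤y)))
... | no m≰y = trans (swap-fixes-below m≤a m≤b (injective-below h m h-inj h-fix y (≰⇒> m≰y)))
                     (cong h (sym (swap-fixes-below m≤a m≤b (≰⇒> m≰y))))

settle-fixesFrom : ∀ h m n → Injective _≡_ _≡_ h → FixesFrom h m → n < m → FixesFrom (settle h n) m
settle-fixesFrom h m n h-inj h-fix n<m x m≤x =
  trans (cong (swap (h n) n) (h-fix x m≤x))
        (swap-fixes-above (injective-below h m h-inj h-fix n n<m) n<m m≤x)

settle-fixesBelow : ∀ g m n → Injective _≡_ _≡_ g → FixesBelow g m → m ≤ n → FixesBelow (settle g n) m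
settle-fixesBelow g m n g-inj g-fix m≤n x x<m =
  trans (cong (swap (g n) n) (g-fix x x<m))
        (swap-fixes-below (injective-above g m g-inj g-fix n m≤n) m≤n x<m)

settle-injective : ∀ f n → Injective _≡_ _≡_ f → Injective _≡_ _≡_ (settle f n)
settle-injective f n f-inj = f-inj ∘ swap-injective (f n) n

sortCost-∘ : ∀ N h g m → Injective _≡_ _≡_ h → Injective _≡_ _≡_ g → FixesFrom h m → FixesBelow g m →
  sortCost (h ∘ g) N ≡ sortCost h N + sortCost g N
sortCost-∘ zero    h g m h-inj g-inj h-fix g-fix = refl
sortCost-∘ (suc n) h g m h-inj g-inj h-fix g-fix with h n ≟ n | g n ≟ n
... | yes hn≡n | yes gn≡n = begin
  sortCost (h ∘ g) (suc n)        ≡⟨ sortCost-fixed (h ∘ g) n (trans (cong h gn≡n) hn≡n) ⟩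
  sortCost (h ∘ g) n              ≡⟨ sortCost-∘ n h g m h-inj g-inj h-fix g-fix ⟩
  sortCost h n + sortCost g n     ≡⟨ cong₂ _+_ (sortCost-fixed h n hn≡n) (sortCost-fixed g n gn≡n) ⟨
  sortCost h (suc n) + sortCost g (suc n) ∎
  where open ≡-Reasoning
... | no hn≢n | yes gn≡n = begin
  sortCost (h ∘ g) (suc n)                  ≡⟨ sortCost-moved (h ∘ g) n (hn≢n ∘ trans (cong h (sym gn≡n))) ⟩
  suc (sortCost (settle (h ∘ g) n) n)       ≡⟨ cong suc (sortCost-cong n _ _ settle-left) ⟩
  suc (sortCost (settle h n ∘ g) n)         ≡⟨ cong suc (sortCost-∘ n (settle h n) g m (settle-injective h n h-inj) g-inj
                                                 (settle-fixesFrom h m n h-inj h-fix n<m) g-fix) ⟩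
  suc (sortCost (settle h n) n + sortCost g n) ≡⟨ cong₂ _+_ (sortCost-moved h n hn≢n) (sortCost-fixed g n gn≡n) ⟨
  sortCost h (suc n) + sortCost g (suc n)   ∎
  where
  open ≡-Reasoning
  n<m : n < m
  n<m = ≰⇒> (hn≢n ∘ h-fix n)
  settle-left : ∀ x → settle (h ∘ g) n x ≡ settle h n (g x)
  settle-left x = cong (λ z → swap z n (h (g x))) (cong h gn≡n)
... | yes hn≡n | no gn≢n = begin
  sortCost (h ∘ g) (suc n)                  ≡⟨ sortCost-moved (h ∘ g) n (gn≢n ∘ trans (sym hgn≡gn)) ⟩
  suc (sortCost (settle (h ∘ g) n) n)       ≡⟨ cong suc (sortCost-cong n _ _ settle-commutes) ⟩
  suc (sortCost (h ∘ settle g n) n)         ≡⟨ cong suc (sortCost-∘ n h (settle g n) m h-inj (settle-injective g n g-inj)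
                                                 h-fix (settle-fixesBelow g m n g-inj g-fix m≤n)) ⟩
  suc (sortCost h n + sortCost (settle g n) n) ≡⟨ +-suc _ _ ⟨
  sortCost h n + suc (sortCost (settle g n) n) ≡⟨ cong₂ _+_ (sortCost-fixed h n hn≡n) (sortCost-moved g n gn≢n) ⟨
  sortCost h (suc n) + sortCost g (suc n)   ∎
  where
  open ≡-Reasoning
  m≤n : m ≤ n
  m≤n = ≮⇒≥ (gn≢n ∘ g-fix n)
  m≤gn : m ≤ g n
  m≤gn = injective-above g m g-inj g-fix n m≤n
  hgn≡gn : h (g n) ≡ g n
  hgn≡gn = h-fix (g n) m≤gn
  settle-commutes : ∀ x → settle (h ∘ g) n x ≡ h (settle g n x)
  settle-commutes x = trans (cong (λ z → swap z n (h (g x))) hgn≡gn)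
                            (swap-commutes-above h m (g n) n h-inj h-fix m≤gn m≤n (g x))
... | no hn≢n | no gn≢n with m ≤? n
...   | yes m≤n = ⊥-elim (hn≢n (h-fix n m≤n))
...   | no m≰n = ⊥-elim (gn≢n (g-fix n (≰⇒> m≰n)))

ValidBelow : ℕ → ℕ × ℕ → Set
ValidBelow N p = proj₁ p < proj₂ p × proj₂ p < N

prodT-permutes : ∀ L f N → PermutesBelow f N → All (ValidBelow N) L → PermutesBelow (prodT L ∘ f) N
prodT-permutes []            f N f-perm []                  = f-perm
prodT-permutes ((s , t) ∷ L) f N f-perm ((s<t , t<N) ∷ valid) =
  swap-permutes _ N s t (prodT-permutes L f N f-perm valid) (<-trans s<t t<N) t<N

sortCost-prodT≤ : ∀ L f N → PermutesBelow f N → All (ValidBelow N) L →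
  sortCost (prodT L ∘ f) N ≤ length L + sortCost f N
sortCost-prodT≤ []            f N f-perm []                  = ≤-refl
sortCost-prodT≤ ((s , t) ∷ L) f N f-perm ((s<t , t<N) ∷ valid) =
  ≤-trans (sortCost-swap≤ N (prodT L ∘ f) s t (prodT-permutes L f N f-perm valid) (<-trans s<t t<N) t<N (<⇒≢ s<t))
          (s≤s (sortCost-prodT≤ L f N f-perm valid))

sortCost-word≤ : ∀ L N → All (ValidBelow N) L → sortCost (prodT L) N ≤ length L
sortCost-word≤ L N valid = begin
  sortCost (prodT L) N          ≤⟨ sortCost-prodT≤ L id N (permutesBelow-id N) valid ⟩
  length L + sortCost id N      ≡⟨ cong (length L +_) (sortCost-id N) ⟩
  length L + 0                  ≡⟨ +-identityʳ _ ⟩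
  length L                      ∎
  where open ≤-Reasoning

-- A word of minimal length for its product, all of whose letters have t ≥ m,
-- whose product keeps [m,N) above m, has all its letters above m: a letter
-- with s < m ≤ t would cross the threshold and (sortCost-swap-cross) could
-- not be cancelled by the remaining letters.
minimal-word-above : ∀ L N m → KeepsAbove (prodT L) m N → sortCost (prodT L) N ≡ length L →
  All (λ p → ValidBelow N p × m ≤ proj₂ p) L → All (λ p → m ≤ proj₁ p) L
minimal-word-above []            N m keeps cost≡ []                              = []
minimal-word-above ((s , t) ∷ L) N m keeps cost≡ (((s<t , t<N) , m≤t) ∷ letters) with m ≤? s
... | no m≰s = ⊥-elim (<⇒≱ (m<n⇒m<1+n (n<1+n (length L))) too-costly)
  where
  valid = All.map proj₁ letters
  permutes : PermutesBelow (prodT ((s , t) ∷ L)) N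
  permutes = prodT-permutes ((s , t) ∷ L) id N (permutesBelow-id N) ((s<t , t<N) ∷ valid)
  too-costly : suc (suc (length L)) ≤ length L
  too-costly = begin
    suc (suc (length L))                              ≡⟨ cong suc cost≡ ⟨
    suc (sortCost (prodT ((s , t) ∷ L)) N)            ≡⟨ sortCost-swap-cross N (prodT ((s , t) ∷ L)) m s t permutes
                                                           keeps (≰⇒> m≰s) m≤t t<N ⟨
    sortCost (swap s t ∘ prodT ((s , t) ∷ L)) N       ≡⟨ sortCost-cong N _ _ (λ x → swap-involutive s t (prodT L x)) ⟩
    sortCost (prodT L) N                              ≤⟨ sortCost-word≤ L N valid ⟩
    length L                                          ∎
    where open ≤-Reasoning
... | yes m≤s = m≤s ∷ minimal-word-above L N m keeps′ cost≡′ letters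
  where
  valid = All.map proj₁ letters
  keeps′ : KeepsAbove (prodT L) m N
  keeps′ x m≤x x<N = subst (m ≤_) (swap-involutive s t (prodT L x))
                           (swap-preserves (m ≤_) s t _ m≤s m≤t (keeps x m≤x x<N))
  cost≡′ : sortCost (prodT L) N ≡ length L
  cost≡′ = ≤-antisym (sortCost-word≤ L N valid) (≤-pred (begin
    suc (length L)                      ≡⟨ cost≡ ⟨
    sortCost (swap s t ∘ prodT L) N     ≤⟨ sortCost-swap≤ N (prodT L) s t (prodT-permutes L id N (permutesBelow-id N) valid)
                                             (<-trans s<t t<N) t<N (<⇒≢ s<t) ⟩
    suc (sortCost (prodT L) N)          ∎))
    where open ≤-Reasoning

iter-+ : ∀ f a b x → iter f (a + b) x ≡ iter f a (iter f b x)
iter-+ f zero    b x = refl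
iter-+ f (suc a) b x = cong f (iter-+ f a b x)

iter-injective : ∀ f → Injective _≡_ _≡_ f → ∀ k {x y} → iter f k x ≡ iter f k y → x ≡ y
iter-injective f f-inj zero    e = e
iter-injective f f-inj (suc k) e = iter-injective f f-inj k (f-inj e)

iter-preserves : ∀ (P : ℕ → Set) f → (∀ y → P y → P (f y)) → ∀ k x → P x → P (iter f k x)
iter-preserves P f closed zero    x px = px
iter-preserves P f closed (suc k) x px = closed _ (iter-preserves P f closed k x px)

IsPeriod : (ℕ → ℕ) → ℕ → ℕ → Set
IsPeriod f i q = 1 ≤ q × iter f q i ≡ i × (∀ l → 1 ≤ l → l < q → iter f l i ≢ i)

iter-return : ∀ f → Injective _≡_ _≡_ f → ∀ i {a b} → a < b → iter f a i ≡ iter f b i → iter f (b ∸ a) i ≡ i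
iter-return f f-inj i {a} {b} a<b e = sym (iter-injective f f-inj a (begin
  iter f a i                  ≡⟨ e ⟩
  iter f b i                  ≡⟨ cong (λ z → iter f z i) (m+[n∸m]≡n (<⇒≤ a<b)) ⟨
  iter f (a + (b ∸ a)) i      ≡⟨ iter-+ f a (b ∸ a) i ⟩
  iter f a (iter f (b ∸ a) i) ∎))
  where open ≡-Reasoning

period-no-repeat : ∀ f i p → Injective _≡_ _≡_ f → IsPeriod f i p →
  ∀ a b → a < b → b < p → iter f a i ≢ iter f b i
period-no-repeat f i p f-inj (_ , _ , minimal) a b a<b b<p e =
  minimal (b ∸ a) (m<n⇒0<n∸m a<b) (≤-<-trans (m∸n≤m b a) b<p) (iter-return f f-inj i a<b e)

cycLenAux-period : ∀ f i F k q → k ≤ q → q < k + F → iter f q i ≡ i →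
  (∀ l → k ≤ l → l < q → iter f l i ≢ i) → cycLenAux f i F k ≡ q
cycLenAux-period f i zero    k q k≤q q<k+0 ret before = ⊥-elim (<⇒≱ q<k+0 (subst (_≤ q) (sym (+-identityʳ k)) k≤q))
cycLenAux-period f i (suc F) k q k≤q q<k+F ret before with iter f k i ≡ᵇ i in test | m≤n⇒m<n∨m≡n k≤q
... | true  | inj₁ k<q = ⊥-elim (before k ≤-refl k<q (≡ᵇ-sound test))
... | true  | inj₂ k≡q = k≡q
... | false | inj₁ k<q = cycLenAux-period f i F (suc k) q k<q (subst (q <_) (+-suc k F) q<k+F) ret
                           (λ l k<l l<q → before l (<⇒≤ k<l) l<q)
... | false | inj₂ refl = ⊥-elim (subst T test (≡⇒≡ᵇ _ _ ret))

cycLenWith : (ℕ → ℕ) → ℕ → ℕ → ℕ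
cycLenWith f F i = cycLenAux f i F 1

cycLenWith-period : ∀ f F i q → IsPeriod f i q → q ≤ F → cycLenWith f F i ≡ q
cycLenWith-period f F i q (1≤q , ret , minimal) q≤F = cycLenAux-period f i F 1 q 1≤q (s≤s q≤F) ret minimal

least-below : (P : ℕ → Set) → (∀ n → Dec (P n)) → ∀ n →
  (Σ ℕ λ l → l < n × P l × (∀ l′ → l′ < l → ¬ P l′)) ⊎ (∀ l → l < n → ¬ P l)
least-below P P? zero = inj₂ (λ l ())
least-below P P? (suc n) with least-below P P? n
... | inj₁ (l , l<n , pl , least) = inj₁ (l , m<n⇒m<1+n l<n , pl , least)
... | inj₂ none with P? n
...   | yes pn = inj₁ (n , ≤-refl , pn , none)
...   | no ¬pn = inj₂ λ l l<1+n → [ none l , (λ { refl → ¬pn }) ]′ (m<1+n⇒m<n∨m≡n l<1+n)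

period-from-return : ∀ f i p → 1 ≤ p → iter f p i ≡ i → Σ ℕ λ q → IsPeriod f i q × q ≤ p
period-from-return f i p 1≤p ret with least-below (λ l → 1 ≤ l × iter f l i ≡ i) returns? (suc p)
  where
  returns? : ∀ l → Dec (1 ≤ l × iter f l i ≡ i)
  returns? l = (1 ≤? l) ×-dec (iter f l i ≟ i)
... | inj₁ (q , q<1+p , (1≤q , retq) , least) = q , (1≤q , retq , λ l 1≤l l<q e → least l l<q (1≤l , e)) , ≤-pred q<1+p
... | inj₂ none = ⊥-elim (none p ≤-refl (1≤p , ret))

-- Every point has a period at most n+1 under an injection fixing [n+1,∞):
-- the orbit of a point below n+1 stays below n+1, so by pigeonhole two of the
-- first n+2 iterates coincide.
period-exists : ∀ f n → Injective _≡_ _≡_ f → FixesFrom f (suc n) → ∀ i → Σ ℕ λ p → IsPeriod f i p × p ≤ suc n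
period-exists f n f-inj f-fix i with suc n ≤? i
... | yes n<i = 1 , (≤-refl , f-fix i n<i , λ l 1≤l l<1 → ⊥-elim (<⇒≱ l<1 1≤l)) , s≤s z≤n
... | no n≮i = let (q , period , q≤d) = period-from-return f i d 1≤d ret in q , period , ≤-trans q≤d d≤1+n
  where
  orbit< : ∀ k → iter f k i < suc n
  orbit< k = iter-preserves (_< suc n) f (injective-below f (suc n) f-inj f-fix) k i (≰⇒> n≮i)
  orbit : Fin (suc (suc n)) → Fin (suc n)
  orbit k = fromℕ< (orbit< (toℕ k))
  collision = pigeonhole ≤-refl orbit
  a = toℕ (proj₁ collision)
  b = toℕ (proj₁ (proj₂ collision))
  a<b : a < b
  a<b = proj₁ (proj₂ (proj₂ collision))
  d = b ∸ a
  1≤d : 1 ≤ d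
  1≤d = m<n⇒0<n∸m a<b
  ret : iter f d i ≡ i
  ret = iter-return f f-inj i a<b
    (trans (sym (toℕ-fromℕ< (orbit< a))) (trans (cong toℕ (proj₂ (proj₂ (proj₂ collision)))) (toℕ-fromℕ< (orbit< b))))
  d≤1+n : d ≤ suc n
  d≤1+n = ≤-trans (m∸n≤m b a) (≤-pred (toℕ<n (proj₁ (proj₂ collision))))

isCycMinAux-sound : ∀ f i L → isCycMinAux f i L ≡ true → ∀ k → 1 ≤ k → k ≤ L → i ≤ iter f k i
isCycMinAux-sound f i zero    test k 1≤k k≤0 = ⊥-elim (<⇒≱ 1≤k k≤0)
isCycMinAux-sound f i (suc L) test k 1≤k k≤L
  with i ≤ᵇ iter f (suc L) i in top | m≤n⇒m<n∨m≡n k≤L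
... | true  | inj₁ k<L  = isCycMinAux-sound f i L test k 1≤k (≤-pred k<L)
... | true  | inj₂ refl = ≤ᵇ⇒≤ i _ (Equivalence.from T-≡ top)

isCycMinAux-complete : ∀ f i L → (∀ k → 1 ≤ k → k ≤ L → i ≤ iter f k i) → isCycMinAux f i L ≡ true
isCycMinAux-complete f i zero    below = refl
isCycMinAux-complete f i (suc L) below
  rewrite Equivalence.to T-≡ (≤⇒≤ᵇ (below (suc L) (s≤s z≤n) ≤-refl)) =
  isCycMinAux-complete f i L (λ k 1≤k k≤L → below k 1≤k (m≤n⇒m≤1+n k≤L))

isCycMinAux-cong : ∀ f g i L → (∀ k → k ≤ L → iter f k i ≡ iter g k i) →
  isCycMinAux f i L ≡ isCycMinAux g i L
isCycMinAux-cong f g i zero    same = refl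
isCycMinAux-cong f g i (suc L) same =
  cong₂ _∧_ (cong (i ≤ᵇ_) (same (suc L) ≤-refl)) (isCycMinAux-cong f g i L (λ k k≤L → same k (m≤n⇒m≤1+n k≤L)))

iter-mod : ∀ f i p → iter f p i ≡ i → ∀ k .{{_ : NonZero p}} → iter f k i ≡ iter f (k % p) i
iter-mod f i p ret k = begin
  iter f k i                                ≡⟨ cong (λ z → iter f z i) (m≡m%n+[m/n]*n k p) ⟩
  iter f (k % p + (k / p) * p) i            ≡⟨ iter-+ f (k % p) ((k / p) * p) i ⟩
  iter f (k % p) (iter f ((k / p) * p) i)   ≡⟨ cong (iter f (k % p)) (multiple (k / p)) ⟩
  iter f (k % p) i                          ∎
  where
  open ≡-Reasoning
  multiple : ∀ c → iter f (c * p) i ≡ i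
  multiple zero    = refl
  multiple (suc c) = trans (iter-+ f p (c * p) i) (trans (cong (iter f p) (multiple c)) ret)

cycMin-orbit : ∀ f i p → IsPeriod f i p → isCycMinAux f i p ≡ true → ∀ k → i ≤ iter f k i
cycMin-orbit f i zero    (() , _) test k
cycMin-orbit f i (suc q) (_ , ret , _) test k with k % suc q in r
... | zero  = subst (i ≤_) (sym (trans (iter-mod f i (suc q) ret k) (cong (λ z → iter f z i) r))) ≤-refl
... | suc r′ = subst (i ≤_) (sym (trans (iter-mod f i (suc q) ret k) (cong (λ z → iter f z i) r)))
                 (isCycMinAux-sound f i (suc q) test (suc r′) (s≤s z≤n)
                   (<⇒≤ (subst (_< suc q) r (m%n<n k (suc q)))))

hits : (ℕ → ℕ) → ℕ → ℕ → ℕ → Bool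
hits f i n zero    = false
hits f i n (suc L) = (iter f L i ≡ᵇ n) ∨ hits f i n L

hits-true : ∀ f i n L → hits f i n L ≡ true → Σ ℕ λ j → j < L × iter f j i ≡ n
hits-true f i n (suc L) test with iter f L i ≡ᵇ n in here
... | true  = L , ≤-refl , ≡ᵇ-sound here
... | false = let (j , j<L , hit) = hits-true f i n L test in j , m<n⇒m<1+n j<L , hit

hits-false : ∀ f i n L → hits f i n L ≡ false → ∀ j → j < L → iter f j i ≢ n
hits-false f i n (suc L) test j j<1+L hit with iter f L i ≡ᵇ n in here | m<1+n⇒m<n∨m≡n j<1+L
... | false | inj₁ j<L  = hits-false f i n L test j j<L hit
... | false | inj₂ refl = subst T here (≡⇒≡ᵇ _ _ hit)

sumTo : (ℕ → ℕ) → ℕ → ℕ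
sumTo g zero    = 0
sumTo g (suc M) = g (suc M) + sumTo g M

sumTo-≤-+ : ∀ g h k M → (∀ i → g i ≤ h i + k i) → sumTo g M ≤ sumTo h M + sumTo k M
sumTo-≤-+ g h k zero    g≤h+k = z≤n
sumTo-≤-+ g h k (suc M) g≤h+k = ≤-trans (+-mono-≤ (g≤h+k (suc M)) (sumTo-≤-+ g h k M g≤h+k))
                                        (≤-reflexive (+-interchange (h (suc M)) (k (suc M)) (sumTo h M) (sumTo k M)))

𝟙 : Bool → ℕ
𝟙 b = if b then 1 else 0

sumTo-𝟙-false : ∀ b M → (∀ i → i ≤ M → b i ≡ false) → sumTo (𝟙 ∘ b) M ≡ 0
sumTo-𝟙-false b zero    never = refl
sumTo-𝟙-false b (suc M) never rewrite never (suc M) ≤-refl = sumTo-𝟙-false b M (λ i i≤M → never i (m≤n⇒m≤1+n i≤M))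

sumTo-𝟙-unique : ∀ b M → (∀ i j → b i ≡ true → b j ≡ true → i ≡ j) → sumTo (𝟙 ∘ b) M ≤ 1
sumTo-𝟙-unique b zero    unique = z≤n
sumTo-𝟙-unique b (suc M) unique with b (suc M) in here
... | false = sumTo-𝟙-unique b M unique
... | true  = ≤-reflexive (cong suc (sumTo-𝟙-false b M never))
  where
  never : ∀ i → i ≤ M → b i ≡ false
  never i i≤M with b i in bi
  ... | false = refl
  ... | true  = ⊥-elim (<⇒≢ (s≤s i≤M) (unique i (suc M) bi here))

contribution : (ℕ → ℕ) → ℕ → ℕ → ℕ
contribution f F i = if isCycMinAux f i (cycLenWith f F i) then cycLenWith f F i ∸ 1 else 0

reducedSize-sum : ∀ τ M → redSizeAux τ M ≡ sumTo (contribution (fun τ) (bound τ)) M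
reducedSize-sum τ zero    = refl
reducedSize-sum τ (suc M) = cong (contribution (fun τ) (bound τ) (suc M) +_) (reducedSize-sum τ M)

contribution-period : ∀ f F i p → IsPeriod f i p → p ≤ F →
  contribution f F i ≡ (if isCycMinAux f i p then p ∸ 1 else 0)
contribution-period f F i p period p≤F =
  cong (λ q → if isCycMinAux f i q then q ∸ 1 else 0) (cycLenWith-period f F i p period p≤F)

contribution-fixed : ∀ f F i → f i ≡ i → 1 ≤ F → contribution f F i ≡ 0
contribution-fixed f F i fi≡i 1≤F
  rewrite contribution-period f F i 1 (≤-refl , fi≡i , λ l 1≤l l<1 → ⊥-elim (<⇒≱ l<1 1≤l)) 1≤F
  with isCycMinAux f i 1
... | true  = refl
... | false = refl

-- Settling the top point n of a permutation f (fixing [n+1,∞), with f n ≢ n)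
-- cuts n out of its cycle and leaves all other cycles unchanged.  Hence each
-- contribution drops by at most one, and only for the least element of the
-- cycle through n.  Throughout, F ≥ n+1 is the fuel of the cycle-length search.
module SettleTop (f : ℕ → ℕ) (n : ℕ) (f-inj : Injective _≡_ _≡_ f) (f-fix : FixesFrom f (suc n))
                 (fn≢n : f n ≢ n) (F : ℕ) (n<F : n < F) where

  f′ : ℕ → ℕ
  f′ = settle f n

  fn<n : f n < n
  fn<n = <-suc-≢ (injective-below f (suc n) f-inj f-fix n ≤-refl) fn≢n

  f′-fix : FixesFrom f′ n
  f′-fix x n≤x with m≤n⇒m<n∨m≡n n≤x
  ... | inj₂ refl = swap-s (f x) x
  ... | inj₁ n<x  = trans (cong (swap (f n) n) (f-fix x n<x))
                          (swap-other (λ x≡fn → <⇒≱ (<-trans n<x (subst (_< n) (sym x≡fn) fn<n)) ≤-refl)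
                                      (<⇒≢ n<x ∘ sym))

  f′-step : ∀ y → y ≢ n → f y ≢ n → f′ y ≡ f y
  f′-step y y≢n fy≢n = swap-other (y≢n ∘ f-inj) fy≢n

  f′-skip : ∀ y → f y ≡ n → f′ y ≡ f n
  f′-skip y fy≡n = trans (cong (swap (f n) n) fy≡n) (swap-t (f n) n)

  orbit-agrees : ∀ i K → (∀ l → l ≤ K → iter f l i ≢ n) → ∀ k → k ≤ K → iter f′ k i ≡ iter f k i
  orbit-agrees i K avoid zero    _   = refl
  orbit-agrees i K avoid (suc k) k<K = trans (cong f′ (orbit-agrees i K avoid k (<⇒≤ k<K)))
                                             (f′-step _ (avoid k (<⇒≤ k<K)) (avoid (suc k) k<K))

  period : ∀ i → Σ ℕ λ p → IsPeriod f i p × p ≤ F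
  period i = let (p , is-period , p≤1+n) = period-exists f n f-inj f-fix i in p , is-period , ≤-trans p≤1+n n<F

  leadsToN : ℕ → Bool
  leadsToN i = isCycMinAux f i (cycLenWith f F i) ∧ hits f i n (cycLenWith f F i)

  leadsToN-period : ∀ i p → IsPeriod f i p → p ≤ F → leadsToN i ≡ (isCycMinAux f i p ∧ hits f i n p)
  leadsToN-period i p is-period p≤F =
    cong (λ q → isCycMinAux f i q ∧ hits f i n q) (cycLenWith-period f F i p is-period p≤F)

  cycMin-≤ : ∀ i i′ p p′ j j′ → IsPeriod f i p → IsPeriod f i′ p′ → isCycMinAux f i p ≡ true →
             iter f j i ≡ n → iter f j′ i′ ≡ n → j′ < p′ → i ≤ i′
  cycMin-≤ i i′ p p′ j j′ is-period is-period′ minimal hit hit′ j′<p′ =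
    subst (i ≤_) reach (cycMin-orbit f i p is-period minimal (c + j))
    where
    open ≡-Reasoning
    c = p′ ∸ j′
    reach : iter f (c + j) i ≡ i′
    reach = begin
      iter f (c + j) i          ≡⟨ iter-+ f c j i ⟩
      iter f c (iter f j i)     ≡⟨ cong (iter f c) (trans hit (sym hit′)) ⟩
      iter f c (iter f j′ i′)   ≡⟨ iter-+ f c j′ i′ ⟨
      iter f (c + j′) i′        ≡⟨ cong (λ z → iter f z i′) (m∸n+n≡m (<⇒≤ j′<p′)) ⟩
      iter f p′ i′              ≡⟨ proj₁ (proj₂ is-period′) ⟩
      i′                        ∎

  -- Only one cycle passes through n, so only one point leads to n.
  leadsToN-unique : ∀ i i′ → leadsToN i ≡ true → leadsToN i′ ≡ true → i ≡ i′
  leadsToN-unique i i′ lead lead′ with period i | period i′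
  ... | (p , is-period , p≤F) | (p′ , is-period′ , p′≤F) =
    ≤-antisym (cycMin-≤ i i′ p p′ j j′ is-period is-period′ minimal hit hit′ j′<p′)
              (cycMin-≤ i′ i p′ p j′ j is-period′ is-period minimal′ hit′ hit j<p)
    where
    both  = trans (sym (leadsToN-period i p is-period p≤F)) lead
    both′ = trans (sym (leadsToN-period i′ p′ is-period′ p′≤F)) lead′
    minimal  = ∧-conicalˡ _ _ both
    minimal′ = ∧-conicalˡ _ _ both′
    j-hit  = hits-true f i n p (∧-conicalʳ _ _ both)
    j′-hit = hits-true f i′ n p′ (∧-conicalʳ _ _ both′)
    j = proj₁ j-hit
    j′ = proj₁ j′-hit
    j<p = proj₁ (proj₂ j-hit)
    j′<p′ = proj₁ (proj₂ j′-hit)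
    hit = proj₂ (proj₂ j-hit)
    hit′ = proj₂ (proj₂ j′-hit)


  -- n itself is not a cycle minimum, since f n < n.
  contribution-n : contribution f F n ≡ 0
  contribution-n with period n
  ... | (p , is-period@(1≤p , _ , _) , p≤F) rewrite contribution-period f F n p is-period p≤F
    with isCycMinAux f n p in minimal
  ...   | true  = ⊥-elim (<⇒≱ fn<n (isCycMinAux-sound f n p minimal 1 ≤-refl 1≤p))
  ...   | false = refl

  -- A cycle avoiding n is a cycle of f′ as well.
  contribution-avoiding : ∀ i p → IsPeriod f i p → p ≤ F → i ≢ n → hits f i n p ≡ false →
    contribution f′ F i ≡ contribution f F i
  contribution-avoiding i p is-period@(1≤p , ret , minimal) p≤F i≢n miss = begin
    contribution f′ F i                                   ≡⟨ contribution-period f′ F i p is-period′ p≤F ⟩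
    (if isCycMinAux f′ i p then p ∸ 1 else 0)             ≡⟨ cong (λ b → if b then p ∸ 1 else 0)
                                                               (isCycMinAux-cong f′ f i p agrees) ⟩
    (if isCycMinAux f i p then p ∸ 1 else 0)              ≡⟨ contribution-period f F i p is-period p≤F ⟨
    contribution f F i                                    ∎
    where
    open ≡-Reasoning
    avoid : ∀ l → l ≤ p → iter f l i ≢ n
    avoid l l≤p with m≤n⇒m<n∨m≡n l≤p
    ... | inj₁ l<p  = hits-false f i n p miss l l<p
    ... | inj₂ refl = i≢n ∘ trans (sym ret)
    agrees = orbit-agrees i p avoid
    is-period′ : IsPeriod f′ i p
    is-period′ = 1≤p , trans (agrees p ≤-refl) ret ,
                 λ l 1≤l l<p → minimal l 1≤l l<p ∘ trans (sym (agrees l (<⇒≤ l<p)))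

  -- The cycle through i, of length q+1, passes through n at step j′+1.  Under
  -- f′ it loses exactly the point n: the f′-orbit of i is the f-orbit with n
  -- removed, so it has length q and keeps its least element.
  module CutCycle (i q j′ : ℕ) (is-period : IsPeriod f i (suc q)) (j<p : suc j′ < suc q)
                  (at-n : iter f (suc j′) i ≡ n) (i≢n : i ≢ n) where

    j = suc j′

    j≤q : j ≤ q
    j≤q = ≤-pred j<p

    1≤q : 1 ≤ q
    1≤q = ≤-trans (s≤s z≤n) j≤q

    before-n : ∀ l → l ≤ j′ → iter f l i ≢ n
    before-n l l≤j′ e = period-no-repeat f i (suc q) f-inj is-period l j (s≤s l≤j′) j<p (trans e (sym at-n))

    after-n : ∀ k → j < k → k ≤ suc q → iter f k i ≢ n
    after-n k j<k k≤p e with m≤n⇒m<n∨m≡n k≤p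
    ... | inj₁ k<p  = period-no-repeat f i (suc q) f-inj is-period j k j<k k<p (trans at-n (sym e))
    ... | inj₂ refl = i≢n (trans (sym (proj₁ (proj₂ is-period))) e)

    early : ∀ k → k ≤ j′ → iter f′ k i ≡ iter f k i
    early = orbit-agrees i j′ before-n

    late : ∀ k → j ≤ k → k ≤ q → iter f′ k i ≡ iter f (suc k) i
    late (suc k) j≤1+k k≤q with m≤n⇒m<n∨m≡n j≤1+k
    ... | inj₂ refl  = trans (cong f′ (early k ≤-refl)) (trans (f′-skip _ at-n) (cong f (sym at-n)))
    ... | inj₁ j<1+k = trans (cong f′ (late k (≤-pred j<1+k) (<⇒≤ k≤q)))
                             (f′-step _ (after-n (suc k) j<1+k (s≤s (<⇒≤ k≤q)))
                                        (after-n (suc (suc k)) (m<n⇒m<1+n j<1+k) (s≤s k≤q)))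

    cut-orbit : ∀ k → k ≤ q → (iter f′ k i ≡ iter f k i) ⊎ (iter f′ k i ≡ iter f (suc k) i)
    cut-orbit k k≤q with k ≤? j′
    ... | yes k≤j′ = inj₁ (early k k≤j′)
    ... | no k≰j′  = inj₂ (late k (≰⇒> k≰j′) k≤q)

    cut-period : IsPeriod f′ i q
    cut-period = 1≤q , trans (late q j≤q ≤-refl) (proj₁ (proj₂ is-period)) , no-return
      where
      no-return : ∀ l → 1 ≤ l → l < q → iter f′ l i ≢ i
      no-return l 1≤l l<q with cut-orbit l (<⇒≤ l<q)
      ... | inj₁ e = proj₂ (proj₂ is-period) l 1≤l (m<n⇒m<1+n l<q) ∘ trans (sym e)
      ... | inj₂ e = proj₂ (proj₂ is-period) (suc l) (s≤s z≤n) (s≤s l<q) ∘ trans (sym e)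

    cut-cycMin : isCycMinAux f i (suc q) ≡ true → isCycMinAux f′ i q ≡ true
    cut-cycMin minimal = isCycMinAux-complete f′ i q above
      where
      above : ∀ k → 1 ≤ k → k ≤ q → i ≤ iter f′ k i
      above k 1≤k k≤q with cut-orbit k k≤q
      ... | inj₁ e = subst (i ≤_) (sym e) (isCycMinAux-sound f i (suc q) minimal k 1≤k (m≤n⇒m≤1+n k≤q))
      ... | inj₂ e = subst (i ≤_) (sym e) (isCycMinAux-sound f i (suc q) minimal (suc k) (s≤s z≤n) (s≤s k≤q))

  contribution-through : ∀ i q → IsPeriod f i (suc q) → suc q ≤ F → hits f i n (suc q) ≡ true →
    ∀ j → j < suc q → iter f j i ≡ n → i ≢ n →
    contribution f F i ≤ contribution f′ F i + 𝟙 (leadsToN i)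
  contribution-through i q is-period p≤F hit zero      _   at-n i≢n = ⊥-elim (i≢n at-n)
  contribution-through i q is-period p≤F hit (suc j′) j<p at-n i≢n
    rewrite contribution-period f F i (suc q) is-period p≤F | leadsToN-period i (suc q) is-period p≤F | hit
    with isCycMinAux f i (suc q) in minimal
  ... | false = z≤n
  ... | true  = ≤-reflexive (begin
    q                                              ≡⟨ m∸n+n≡m 1≤q ⟨
    q ∸ 1 + 1                                      ≡⟨ cong (λ b → (if b then q ∸ 1 else 0) + 1) (cut-cycMin minimal) ⟨
    (if isCycMinAux f′ i q then q ∸ 1 else 0) + 1  ≡⟨ cong (_+ 1) (contribution-period f′ F i q cut-period
                                                         (≤-trans (n≤1+n q) p≤F)) ⟨
    contribution f′ F i + 1                        ∎)
    where
    open ≡-Reasoning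
    open CutCycle i q j′ is-period j<p at-n i≢n

  contribution-settle : ∀ i → contribution f F i ≤ contribution f′ F i + 𝟙 (leadsToN i)
  contribution-settle i with i ≟ n
  ... | yes refl = ≤-trans (≤-reflexive contribution-n) z≤n
  ... | no i≢n with period i
  ...   | (zero , (() , _) , _)
  ...   | (suc q , is-period , p≤F) with hits f i n (suc q) in test
  ...     | false = ≤-trans (≤-reflexive (sym (contribution-avoiding i (suc q) is-period p≤F i≢n test))) (m≤m+n _ _)
  ...     | true  = let (j , j<p , at-n) = hits-true f i n (suc q) test in
                    contribution-through i q is-period p≤F test j j<p at-n i≢n

-- The reduced cycle-type size is bounded by the sort cost: settling the top
-- point costs one transposition and lowers the sum of contributions by at
-- most one (SettleTop).
contributions≤sortCost : ∀ B f F → Injective _≡_ _≡_ f → FixesFrom f B → B ≤ F →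
  sumTo (contribution f F) B ≤ sortCost f B
contributions≤sortCost zero    f F f-inj f-fix B≤F = z≤n
contributions≤sortCost (suc n) f F f-inj f-fix n<F with f n ≟ n
... | yes fn≡n = begin
  C (suc n) + sumTo C n   ≡⟨ cong (_+ sumTo C n) (contribution-fixed f F (suc n) (f-fix (suc n) ≤-refl) (<-≤-trans z<s n<F)) ⟩
  sumTo C n               ≤⟨ contributions≤sortCost n f F f-inj f-fix′ (<⇒≤ n<F) ⟩
  sortCost f n            ≡⟨ sortCost-fixed f n fn≡n ⟨
  sortCost f (suc n)      ∎
  where
  open ≤-Reasoning
  C = contribution f F
  f-fix′ : FixesFrom f n
  f-fix′ x n≤x = [ f-fix x , (λ { refl → fn≡n }) ]′ (m≤n⇒m<n∨m≡n n≤x)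
... | no fn≢n = begin
  sumTo C (suc n)                              ≤⟨ sumTo-≤-+ C C′ (𝟙 ∘ leadsToN) (suc n) contribution-settle ⟩
  sumTo C′ (suc n) + sumTo (𝟙 ∘ leadsToN) (suc n) ≤⟨ +-monoʳ-≤ (sumTo C′ (suc n)) (sumTo-𝟙-unique leadsToN (suc n) leadsToN-unique) ⟩
  C′ (suc n) + sumTo C′ n + 1                  ≡⟨ cong (λ c → c + sumTo C′ n + 1) top-fixed ⟩
  sumTo C′ n + 1                               ≤⟨ +-monoˡ-≤ 1 (contributions≤sortCost n f′ F (settle-injective f n f-inj) f′-fix (<⇒≤ n<F)) ⟩
  sortCost f′ n + 1                            ≡⟨ +-comm _ 1 ⟩
  suc (sortCost f′ n)                          ≡⟨ sortCost-moved f n fn≢n ⟨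
  sortCost f (suc n)                           ∎
  where
  open ≤-Reasoning
  open SettleTop f n f-inj f-fix fn≢n F n<F
  C = contribution f F
  C′ = contribution f′ F
  top-fixed : C′ (suc n) ≡ 0
  top-fixed = contribution-fixed f′ F (suc n) (f′-fix (suc n) (n≤1+n n)) (<-≤-trans z<s n<F)

reducedSize≤sortCost : ∀ τ N → bound τ ≤ N → reducedSize τ ≤ sortCost (fun τ) N
reducedSize≤sortCost τ N B≤N = begin
  reducedSize τ                                          ≡⟨ reducedSize-sum τ (bound τ) ⟩
  sumTo (contribution (fun τ) (bound τ)) (bound τ)       ≤⟨ contributions≤sortCost (bound τ) (fun τ) (bound τ)
                                                              (fun-injective τ) (fixHigh τ) ≤-refl ⟩
  sortCost (fun τ) (bound τ)                             ≡⟨ sortCost-stable (fun τ) (bound τ) N B≤N (fixHigh τ) ⟨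
  sortCost (fun τ) N                                     ∎
  where open ≤-Reasoning

Lower : (ℕ → ℕ) → ℕ → Set
Lower f m = FixesFrom f m × (∀ x → x < m → f x < m)

Upper : (ℕ → ℕ) → ℕ → Set
Upper f m = FixesBelow f m × (∀ x → m ≤ x → m ≤ f x)

prodT-lower : ∀ m L → All (λ p → proj₁ p < m × proj₂ p < m) L → Lower (prodT L) m
prodT-lower m []            []                 = (λ x _ → refl) , (λ x x<m → x<m)
prodT-lower m ((s , t) ∷ L) ((s<m , t<m) ∷ ps) =
  (λ x m≤x → trans (cong (swap s t) (fixes x m≤x)) (swap-fixes-above s<m t<m m≤x)) ,
  (λ x x<m → swap-preserves (_< m) s t _ s<m t<m (maps x x<m))
  where
  fixes = proj₁ (prodT-lower m L ps)
  maps  = proj₂ (prodT-lower m L ps)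

prodT-upper : ∀ m L → All (λ p → m ≤ proj₁ p × m ≤ proj₂ p) L → Upper (prodT L) m
prodT-upper m []            []                 = (λ x _ → refl) , (λ x m≤x → m≤x)
prodT-upper m ((s , t) ∷ L) ((m≤s , m≤t) ∷ ps) =
  (λ x x<m → trans (cong (swap s t) (fixes x x<m)) (swap-fixes-below m≤s m≤t x<m)) ,
  (λ x m≤x → swap-preserves (m ≤_) s t _ m≤s m≤t (maps x m≤x))
  where
  fixes = proj₁ (prodT-upper m L ps)
  maps  = proj₂ (prodT-upper m L ps)

separated-factors-unique : ∀ (h₁ h₂ a b : ℕ → ℕ) m → Lower h₁ m → Upper h₂ m → Lower a m → Upper b m →
  (∀ x → h₁ (h₂ x) ≡ a (b x)) → (∀ x → h₁ x ≡ a x) × (∀ x → h₂ x ≡ b x)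
separated-factors-unique h₁ h₂ a b m (h₁-fix , _) (h₂-fix , h₂-up) (a-fix , _) (b-fix , b-up) same =
  first , second
  where
  first : ∀ x → h₁ x ≡ a x
  first x with m ≤? x
  ... | yes m≤x = trans (h₁-fix x m≤x) (sym (a-fix x m≤x))
  ... | no m≰x  = trans (cong h₁ (sym (h₂-fix x (≰⇒> m≰x)))) (trans (same x) (cong a (b-fix x (≰⇒> m≰x))))
  second : ∀ x → h₂ x ≡ b x
  second x with m ≤? x
  ... | yes m≤x = trans (sym (h₁-fix _ (h₂-up x m≤x))) (trans (same x) (a-fix _ (b-up x m≤x)))
  ... | no m≰x  = trans (h₂-fix x (≰⇒> m≰x)) (sym (b-fix x (≰⇒> m≰x)))

keepsAbove-right-factor : ∀ (g a b : ℕ → ℕ) m N → (∀ x → g x ≡ a (b x)) → (∀ x → x < m → a x < m) →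
  (∀ x → m ≤ x → m ≤ g x) → KeepsAbove b m N
keepsAbove-right-factor g a b m N g≡ab a-low g-up x m≤x _ with m ≤? b x
... | yes m≤bx = m≤bx
... | no m≰bx  = ⊥-elim (<⇒≱ (a-low (b x) (≰⇒> m≰bx)) (subst (m ≤_) (g≡ab x) (g-up x m≤x)))

minimal-suffix : ∀ P S N → All (ValidBelow N) P → All (ValidBelow N) S →
  length P + length S ≤ sortCost (prodT P ∘ prodT S) N → sortCost (prodT S) N ≡ length S
minimal-suffix P S N P-valid S-valid long = ≤-antisym (sortCost-word≤ S N S-valid)
  (+-cancelˡ-≤ (length P) _ _ (≤-trans long
    (sortCost-prodT≤ P (prodT S) N (prodT-permutes S id N (permutesBelow-id N) S-valid) P-valid)))

split-at : ∀ m (L : List (ℕ × ℕ)) → Linked _≤_ (map proj₂ L) →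
  Σ ℕ λ k → All (λ p → proj₂ p < m) (take k L) × All (λ p → m ≤ proj₂ p) (drop k L)
split-at m []      _      = 0 , [] , []
split-at m (p ∷ L) sorted with m ≤? proj₂ p
... | yes m≤t = 0 , [] , All.map⁻ (Linked⇒All ≤-trans m≤t sorted)
... | no m≰t  = let (k , low , high) = split-at m L (Linked.tail sorted) in suc k , ≰⇒> m≰t ∷ low , high

prodT-take-drop : ∀ k (L : List (ℕ × ℕ)) x → prodT (take k L) (prodT (drop k L) x) ≡ prodT L x
prodT-take-drop zero    L             x = refl
prodT-take-drop (suc k) []            x = refl
prodT-take-drop (suc k) ((s , t) ∷ L) x = cong (swap s t) (prodT-take-drop k L x)

take-length-take : ∀ {A : Set} k (L : List A) → take (length (take k L)) L ≡ take k L
take-length-take zero    L       = refl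
take-length-take (suc k) []      = refl
take-length-take (suc k) (p ∷ L) = cong (p ∷_) (take-length-take k L)

drop-length-take : ∀ {A : Set} k (L : List A) → drop (length (take k L)) L ≡ drop k L
drop-length-take zero    L       = refl
drop-length-take (suc k) []      = refl
drop-length-take (suc k) (p ∷ L) = drop-length-take k L

threshold : (τ₁ τ₂ : FinPerm) → (∀ i j → InSupp τ₁ i → InSupp τ₂ j → i < j) →
  Σ ℕ λ m → FixesFrom (fun τ₁) m × FixesBelow (fun τ₂) m
threshold τ₁ τ₂ sep with least-below (InSupp τ₂) (λ j → ¬? (fun τ₂ j ≟ j)) (bound τ₁)
... | inj₁ (j , _ , moves , least) =
  j , (λ x j≤x → decidable-stable (fun τ₁ x ≟ x) (λ moved → <⇒≱ (sep x j moved moves) j≤x)) ,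
      (λ x x<j → decidable-stable (fun τ₂ x ≟ x) (least x x<j))
... | inj₂ none = bound τ₁ , fixHigh τ₁ , (λ x x<B → decidable-stable (fun τ₂ x ≟ x) (none x x<B))

word-bound : ∀ B (L : List (ℕ × ℕ)) → Σ ℕ λ N → B ≤ N × All (λ p → proj₂ p < N) L
word-bound B []            = B , ≤-refl , []
word-bound B ((s , t) ∷ L) =
  let (N , B≤N , below) = word-bound B L in
  N + suc t , ≤-trans B≤N (m≤m+n N _) , m≤n+m (suc t) N ∷ All.map (λ t<N → ≤-trans t<N (m≤m+n N _)) below

module SeparatedWord (τ₁ τ₂ : FinPerm) (m N : ℕ) (P S : List (ℕ × ℕ))
  (fix₁ : FixesFrom (fun τ₁) m) (fix₂ : FixesBelow (fun τ₂) m) (B₁≤N : bound τ₁ ≤ N) (B₂≤N : bound τ₂ ≤ N)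
  (P-valid : All (ValidBelow N) P) (S-valid : All (ValidBelow N) S)
  (P-low : All (λ p → proj₂ p < m) P) (S-high : All (λ p → m ≤ proj₂ p) S)
  (len : length P + length S ≡ reducedSize τ₁ + reducedSize τ₂)
  (σ≡PS : ∀ x → fun τ₁ (fun τ₂ x) ≡ prodT P (prodT S x)) where

  h₁ = fun τ₁
  h₂ = fun τ₂

  τ₁-lower : Lower h₁ m
  τ₁-lower = fix₁ , injective-below h₁ m (fun-injective τ₁) fix₁

  τ₂-upper : Upper h₂ m
  τ₂-upper = fix₂ , injective-above h₂ m (fun-injective τ₂) fix₂

  P-lower : Lower (prodT P) m
  P-lower = prodT-lower m P (All.zipWith (λ ((s<t , _) , t<m) → <-trans s<t t<m , t<m) (P-valid , P-low))

  r₁≤ : reducedSize τ₁ ≤ sortCost h₁ N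
  r₁≤ = reducedSize≤sortCost τ₁ N B₁≤N

  r₂≤ : reducedSize τ₂ ≤ sortCost h₂ N
  r₂≤ = reducedSize≤sortCost τ₂ N B₂≤N

  -- by (a) and (c), the word is no longer than the sort cost of its product
  word≤sortCost : length P + length S ≤ sortCost (prodT P ∘ prodT S) N
  word≤sortCost = begin
    length P + length S                       ≡⟨ len ⟩
    reducedSize τ₁ + reducedSize τ₂           ≤⟨ +-mono-≤ r₁≤ r₂≤ ⟩
    sortCost h₁ N + sortCost h₂ N             ≡⟨ sortCost-∘ N h₁ h₂ m (fun-injective τ₁) (fun-injective τ₂) fix₁ fix₂ ⟨
    sortCost (h₁ ∘ h₂) N                      ≡⟨ sortCost-cong N _ _ σ≡PS ⟩
    sortCost (prodT P ∘ prodT S) N            ∎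
    where open ≤-Reasoning

  -- so S is a minimal word whose product keeps [m,N) above m: no letter crosses m
  S-above : All (λ p → m ≤ proj₁ p) S
  S-above = minimal-word-above S N m
    (keepsAbove-right-factor (h₁ ∘ h₂) (prodT P) (prodT S) m N σ≡PS (proj₂ P-lower)
      (λ x m≤x → subst (m ≤_) (sym (fix₁ _ (proj₂ τ₂-upper x m≤x))) (proj₂ τ₂-upper x m≤x)))
    (minimal-suffix P S N P-valid S-valid word≤sortCost) (All.zip (S-valid , S-high))

  factors : (∀ x → h₁ x ≡ prodT P x) × (∀ x → h₂ x ≡ prodT S x)
  factors = separated-factors-unique h₁ h₂ (prodT P) (prodT S) m τ₁-lower τ₂-upper P-lower
              (prodT-upper m S (All.zip (S-above , S-high))) σ≡PS

  -- each factor needs at least as many letters as its reduced size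
  P-length : length P ≡ reducedSize τ₁
  P-length = ≤-antisym (+-cancelʳ-≤ (length S) _ _ (≤-trans (≤-reflexive len) (+-monoʳ-≤ _ r₂≤S))) r₁≤P
    where
    r₁≤P : reducedSize τ₁ ≤ length P
    r₁≤P = ≤-trans r₁≤ (≤-trans (≤-reflexive (sortCost-cong N _ _ (proj₁ factors))) (sortCost-word≤ P N P-valid))
    r₂≤S : reducedSize τ₂ ≤ length S
    r₂≤S = ≤-trans r₂≤ (≤-trans (≤-reflexive (sortCost-cong N _ _ (proj₂ factors))) (sortCost-word≤ S N S-valid))

lemma5p17 : (τ₁ τ₂ : FinPerm) (r₁ r₂ : ℕ)
    → (∀ i j → InSupp τ₁ i → InSupp τ₂ j → i < j)
    → reducedSize τ₁ ≡ r₁ → reducedSize τ₂ ≡ r₂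
    → (st : List (ℕ × ℕ))
    → length st ≡ r₁ + r₂
    → All (λ p → 1 ≤ proj₁ p × proj₁ p < proj₂ p × 2 ≤ proj₂ p) st
    → Linked _≤_ (map proj₂ st)
    → (τ₁ · τ₂) ≗ₚ prodT st
    → (fun τ₁ ≗ₚ prodT (take r₁ st)) × (fun τ₂ ≗ₚ prodT (drop r₁ st))
lemma5p17 τ₁ τ₂ _ _ sep refl refl st len letters sorted σ≡st =
  subst (λ L → fun τ₁ ≗ₚ prodT L) (sym (cut-at-r₁ take (take-length-take k st))) (proj₁ factors) ,
  subst (λ L → fun τ₂ ≗ₚ prodT L) (sym (cut-at-r₁ drop (drop-length-take k st))) (proj₂ factors)
  where
  -- cut the word where the t's reach a threshold m between the supports
  thr = threshold τ₁ τ₂ sep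
  m = proj₁ thr
  cut = split-at m st sorted
  k = proj₁ cut
  N-bound = word-bound (bound τ₁ + bound τ₂) st
  N = proj₁ N-bound
  valid : All (ValidBelow N) st
  valid = All.zipWith (λ ((_ , s<t , _) , t<N) → s<t , t<N) (letters , proj₂ (proj₂ N-bound))
  open SeparatedWord τ₁ τ₂ m N (take k st) (drop k st) (proj₁ (proj₂ thr)) (proj₂ (proj₂ thr))
    (≤-trans (m≤m+n _ _) (proj₁ (proj₂ N-bound))) (≤-trans (m≤n+m _ _) (proj₁ (proj₂ N-bound)))
    (take⁺ k valid) (drop⁺ k valid) (proj₁ (proj₂ cut)) (proj₂ (proj₂ cut))
    (trans (sym (length-++ (take k st))) (trans (cong length (take++drop≡id k st)) len))
    (λ x → trans (σ≡st x) (sym (prodT-take-drop k st x)))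
  cut-at-r₁ : (op : ℕ → List (ℕ × ℕ) → List (ℕ × ℕ)) → op (length (take k st)) st ≡ op k st →
    op (reducedSize τ₁) st ≡ op k st
  cut-at-r₁ op same = trans (cong (λ r → op r st) (sym P-length)) same
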